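{- For every integer $n \geq 4$, $\nabla(C_{4} \times C_{n}) = \left\lceil \frac{3}{2} n \right\rceil$.
   Context: For a simple graph $G$, a set $S \subseteq V(G)$ is a decycling set of $G$ if the graph $G - S$ obtained by deleting the vertices of $S$ is acyclic (a forest). The decycling number $\nabla(G)$ is the minimum cardinality of a decycling set of $G$. $C_k$ denotes the cycle on $k$ vertices, and $G \times H$ denotes the Cartesian product of graphs: vertex set $V(G)\times V(H)$, with $(g,h)$ adjacent to $(g',h')$ iff either $g=g'$ and $hh' \in E(H)$, or $h=h'$ and $gg' \in E(G)$. -}

module Defs where

open import Level using (0ℓ)
open import Data.Nat using (ℕ; zero; suc; _+_; _≤_; ⌈_/2⌉; _*_)
open import Data.Fin using (Fin; toℕ)
open import Data.Product using (_×_; Σ; ∃; _,_)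
open import Data.Sum using (_⊎_)
open import Data.List using (List; length)
open import Data.List.Membership.Propositional using (_∉_)
open import Data.List.Relation.Unary.Unique.Propositional using (Unique)
open import Function.Definitions using (Injective)
open import Relation.Binary.PropositionalEquality using (_≡_)
open import Relation.Nullary using (¬_)

record Graph : Set₁ where
  field
    V   : Set
    Adj : V → V → Set
open Graph public

Succ : (k : ℕ) → Fin k → Fin k → Set
Succ k i j = (toℕ j ≡ suc (toℕ i)) ⊎ ((suc (toℕ i) ≡ k) × (toℕ j ≡ 0))

C : ℕ → Graph
C k = record { V = Fin k ; Adj = λ i j → Succ k i j ⊎ Succ k j i }

_□_ : Graph → Graph → Graph
G □ H = record
  { V   = V G × V H
  ; Adj = λ { (g , h) (g' , h') →
              ((g ≡ g') × Adj H h h') ⊎ ((h ≡ h') × Adj G g g') } }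

-- A cycle of length 3+m in G avoiding the vertex list S (i.e. a cycle of
-- the graph G - S): an injective map from the vertices of C_(3+m) into
-- the vertices of G - S sending edges to edges.
CycleAvoiding : (G : Graph) → List (V G) → ℕ → Set
CycleAvoiding G S m =
  Σ (Fin (3 + m) → V G) λ f →
    Injective _≡_ _≡_ f ×
    (∀ i → f i ∉ S) ×
    (∀ i j → Adj (C (3 + m)) i j → Adj G (f i) (f j))

AcyclicAfterRemoving : (G : Graph) → List (V G) → Set
AcyclicAfterRemoving G S = ∀ m → ¬ CycleAvoiding G S m

IsDecyclingSet : (G : Graph) → List (V G) → Set
IsDecyclingSet G S = Unique S × AcyclicAfterRemoving G S

DecyclingNumber : Graph → ℕ → Set
DecyclingNumber G d =
  (Σ (List (V G)) λ S → IsDecyclingSet G S × length S ≡ d) ×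
  (∀ S → IsDecyclingSet G S → d ≤ length S)

module Submission where

-- Two adjacent columns of C₄ × Cₙ induce a cube C₄ × C₂, and a decycling set must
-- contain at least three vertices of every such cube: any two vertices of the cube
-- miss one of its faces, or, if they are antipodal, one of its hexagonal belts.
-- Summing over the n pairs of adjacent columns counts every vertex twice, so a
-- decycling set S has 2|S| ≥ 3n.
--
-- Conversely write n = ℓ + 4k with 4 ≤ ℓ ≤ 7, and delete vertices column by column
-- following a block of length ℓ and then k blocks of length 4; a block of length ℓ
-- deletes ⌈3ℓ/2⌉ vertices. The kept vertices carry ranks such that each of them has
-- at most one kept neighbour of smaller or equal rank, which rules out cycles. That
-- condition only involves three consecutive columns, so it is checked by evaluation
-- for all the ways in which blocks can follow each other.

open import Defs

open import Data.Bool using (T)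
open import Data.Empty using (⊥; ⊥-elim)
open import Data.Fin using (Fin; zero; suc; toℕ; fromℕ; fromℕ<; inject₁; _≟_)
open import Data.Fin.Patterns using (0F; 1F; 2F; 3F)
open import Data.Fin.Permutation using (Permutation′; permutation)
open import Data.Fin.Properties
  using (toℕ-injective; toℕ<n; toℕ-fromℕ<; toℕ-fromℕ; toℕ-inject₁; all?)
open import Data.List using (List; []; _∷_; length; allFin; map; _++_; concat; tabulate; filter)
open import Data.List.Extrema.Nat using (argmax; f[xs]≤f[argmax])
open import Data.List.Membership.Propositional using (_∈_; _∉_)
open import Data.List.Membership.Propositional.Properties
  using (∈-allFin; ∈-∃++; ∈-++⁻; ∈-++⁺ˡ; ∈-++⁺ʳ; ∈-concat⁺′; ∈-concat⁻′; ∈-map⁺; ∈-map⁻;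
         ∈-tabulate⁺; ∈-tabulate⁻; ∈-filter⁺; ∈-filter⁻)
open import Data.List.Properties using (length-++; length-map)
open import Data.List.Relation.Binary.Disjoint.Propositional using (Disjoint)
open import Data.List.Relation.Binary.Subset.Propositional using (_⊆_)
open import Data.List.Relation.Unary.All as All using (All)
import Data.List.Relation.Unary.All.Properties as Allₚ
import Data.List.Relation.Unary.AllPairs.Properties as AllPairs
open import Data.List.Relation.Unary.Any as Any using (Any; here; there)
open import Data.List.Relation.Unary.Unique.Propositional using (Unique; []; _∷_)
open import Data.List.Relation.Unary.Unique.Propositional.Properties
  using (concat⁺; map⁺; filter⁺; allFin⁺)
open import Data.Maybe using (Maybe; just; nothing; is-nothing; fromMaybe)
open import Data.Nat using (ℕ; zero; suc; _+_; _*_; _≤_; z≤n; s≤s; ⌈_/2⌉; _<?_)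
import Data.Nat as ℕ
open import Data.Nat.DivMod using (_divMod_; result)
open import Data.Nat.GeneralisedArithmetic using (fold; fold-+)
open import Data.Nat.Properties
  using (≤-refl; ≤-reflexive; ≤-trans; ≤-antisym; <-irrefl; <-trans; ≮⇒≥; n<1+n; 1+n≢n; 0≢1+n;
         suc-injective; +-comm; +-assoc; +-suc; +-mono-≤; *-comm; ⌈n/2⌉-mono; n≡⌈n+n/2⌉;
         +-0-commutativeMonoid; module ≤-Reasoning)
open import Data.Nat.Tactic.RingSolver using (solve-∀)
open import Data.Product as Product using (_×_; Σ; ∃-syntax; _,_; proj₁; proj₂; uncurry)
open import Data.Product.Properties using (≡-dec)
open import Data.Sum using (_⊎_; inj₁; inj₂; [_,_])
open import Data.Unit using (tt)
open import Data.Vec as Vec using (Vec; _∷_; [])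
open import Function using (_∘_)
open import Function.Definitions using (Injective)
open import Relation.Binary.PropositionalEquality
  using (_≡_; _≢_; refl; sym; trans; cong; cong₂; subst; subst₂; module ≡-Reasoning)
open import Relation.Nullary using (¬_; Dec; yes; no; ¬?)
open import Relation.Nullary.Decidable using (_⊎-dec_; _×-dec_; _→-dec_; map′; toWitness; T?)
open import Algebra.Properties.CommutativeMonoid.Sum +-0-commutativeMonoid
  using (sum-syntax; sum-cong-≗; ∑-distrib-+; ∑-permute)

module _ {k : ℕ} where

  next : Fin (suc k) → Fin (suc k)
  next i with suc (toℕ i) <? suc k
  ... | yes i+1<k = fromℕ< i+1<k
  ... | no _ = zero

  prev : Fin (suc k) → Fin (suc k)
  prev zero = fromℕ k
  prev (suc i) = inject₁ i

  Succ-next : ∀ i → Succ (suc k) i (next i)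
  Succ-next i with suc (toℕ i) <? suc k
  ... | yes i+1<k = inj₁ (toℕ-fromℕ< i+1<k)
  ... | no i+1≮k = inj₂ (≤-antisym (toℕ<n i) (≮⇒≥ i+1≮k) , refl)

  Succ-prev : ∀ i → Succ (suc k) (prev i) i
  Succ-prev zero = inj₂ (cong suc (toℕ-fromℕ k) , refl)
  Succ-prev (suc i) = inj₁ (cong suc (sym (toℕ-inject₁ i)))

module _ {k : ℕ} where

  Succ-functional : ∀ {i j j′ : Fin k} → Succ k i j → Succ k i j′ → j ≡ j′
  Succ-functional (inj₁ j≡i+1) (inj₁ j′≡i+1) = toℕ-injective (trans j≡i+1 (sym j′≡i+1))
  Succ-functional {j = j} (inj₁ j≡i+1) (inj₂ (i+1≡k , _)) =
    ⊥-elim (<-irrefl (trans j≡i+1 i+1≡k) (toℕ<n j))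
  Succ-functional {j′ = j′} (inj₂ (i+1≡k , _)) (inj₁ j′≡i+1) =
    ⊥-elim (<-irrefl (trans j′≡i+1 i+1≡k) (toℕ<n j′))
  Succ-functional (inj₂ (_ , j≡0)) (inj₂ (_ , j′≡0)) = toℕ-injective (trans j≡0 (sym j′≡0))

  Succ-injective : ∀ {i i′ j : Fin k} → Succ k i j → Succ k i′ j → i ≡ i′
  Succ-injective (inj₁ j≡i+1) (inj₁ j≡i′+1) = toℕ-injective (suc-injective (trans (sym j≡i+1) j≡i′+1))
  Succ-injective (inj₁ j≡i+1) (inj₂ (_ , j≡0)) = ⊥-elim (0≢1+n (trans (sym j≡0) j≡i+1))
  Succ-injective (inj₂ (_ , j≡0)) (inj₁ j≡i′+1) = ⊥-elim (0≢1+n (trans (sym j≡0) j≡i′+1))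
  Succ-injective (inj₂ (i+1≡k , _)) (inj₂ (i′+1≡k , _)) =
    toℕ-injective (suc-injective (trans i+1≡k (sym i′+1≡k)))

  Succ-irrefl : 2 ≤ k → ∀ {i : Fin k} → ¬ Succ k i i
  Succ-irrefl _ (inj₁ i≡i+1) = 1+n≢n (sym i≡i+1)
  Succ-irrefl 2≤k (inj₂ (i+1≡k , i≡0)) = <-irrefl (trans (cong suc (sym i≡0)) i+1≡k) 2≤k

  Succ-asym : 3 ≤ k → ∀ {i j : Fin k} → Succ k i j → ¬ Succ k j i
  Succ-asym _ (inj₁ j≡i+1) (inj₁ i≡j+1) = <-irrefl (trans i≡j+1 (cong suc j≡i+1)) (<-trans (n<1+n _) (n<1+n _))
  Succ-asym 3≤k (inj₁ j≡i+1) (inj₂ (j+1≡k , i≡0)) =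
    <-irrefl (trans (sym (cong suc (trans j≡i+1 (cong suc i≡0)))) j+1≡k) 3≤k
  Succ-asym 3≤k (inj₂ (i+1≡k , j≡0)) (inj₁ i≡j+1) =
    <-irrefl (trans (sym (cong suc (trans i≡j+1 (cong suc j≡0)))) i+1≡k) 3≤k
  Succ-asym 3≤k (inj₂ (i+1≡k , _)) (inj₂ (_ , i≡0)) =
    <-irrefl (trans (cong suc (sym i≡0)) i+1≡k) (≤-trans (s≤s (s≤s z≤n)) 3≤k)

module _ {k : ℕ} where

  next-prev : ∀ i → next (prev i) ≡ i
  next-prev i = Succ-functional (Succ-next {k} (prev i)) (Succ-prev i)

  prev-next : ∀ i → prev (next i) ≡ i
  prev-next i = Succ-injective (Succ-prev {k} (next i)) (Succ-next i)

  rotation : Permutation′ (suc k)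
  rotation = permutation (next {k}) (prev {k}) next-prev prev-next

  C-neighbour : ∀ {i j : Fin (suc k)} → Adj (C (suc k)) i j → j ≡ next i ⊎ j ≡ prev i
  C-neighbour {i} (inj₁ i→j) = inj₁ (Succ-functional i→j (Succ-next i))
  C-neighbour {i} (inj₂ j→i) = inj₂ (Succ-injective j→i (Succ-prev i))

∃-maximum : ∀ {k} (g : Fin (suc k) → ℕ) → ∃[ i ] (∀ j → g j ≤ g i)
∃-maximum {k} g = argmax g zero (allFin (suc k)) ,
  λ j → All.lookup (f[xs]≤f[argmax] {f = g} zero (allFin (suc k))) (∈-allFin j)

-- A vertex of maximal rank on a cycle would have two distinct neighbours of smaller
-- or equal rank on it.
acyclic-by-rank : (G : Graph) (S : List (V G)) (rank : V G → ℕ) →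
  (∀ {v u w} → v ∉ S → u ∉ S → w ∉ S → Adj G v u → Adj G v w →
     rank u ≤ rank v → rank w ≤ rank v → u ≡ w) →
  AcyclicAfterRemoving G S
acyclic-by-rank G S rank lower-unique m (f , f-injective , avoids , edges) = no-top (∃-maximum (rank ∘ f))
  where
  no-top : ¬ (∃[ top ] (∀ j → rank (f j) ≤ rank (f top)))
  no-top (top , maximal) = Succ-asym {k = 3 + m} (s≤s (s≤s (s≤s z≤n))) (Succ-next top) next→top
    where
    next≡prev : next top ≡ prev top
    next≡prev = f-injective {next top} {prev top} (lower-unique {f top} {f (next top)} {f (prev top)}
      (avoids top) (avoids (next top)) (avoids (prev top))
      (edges top (next top) (inj₁ (Succ-next top))) (edges top (prev top) (inj₂ (Succ-prev top)))
      (maximal (next top)) (maximal (prev top)))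
    next→top : Succ (3 + m) (next top) top
    next→top = subst (λ j → Succ (3 + m) j top) (sym next≡prev) (Succ-prev top)

cycle-avoiding-⊆ : ∀ {G : Graph} {S T : List (V G)} {m} → S ⊆ T → CycleAvoiding G T m → CycleAvoiding G S m
cycle-avoiding-⊆ S⊆T (f , f-injective , avoids , edges) = f , f-injective , (λ i → avoids i ∘ S⊆T) , edges

acyclic-pullback : ∀ {G H : Graph} (φ : V H → V G) → Injective _≡_ _≡_ φ →
  (∀ {x y} → Adj H x y → Adj G (φ x) (φ y)) →
  ∀ {S T} → (∀ {x} → φ x ∈ S → x ∈ T) → AcyclicAfterRemoving G S → AcyclicAfterRemoving H T
acyclic-pullback φ φ-injective φ-adj back acyclic m (f , f-injective , avoids , edges) =
  acyclic m (φ ∘ f , f-injective ∘ φ-injective , (λ i → avoids i ∘ back) , λ i j → φ-adj ∘ edges i j)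

Unique∧⊆⇒length≤ : ∀ {A : Set} {xs ys : List A} → Unique xs → xs ⊆ ys → length xs ≤ length ys
Unique∧⊆⇒length≤ [] _ = z≤n
Unique∧⊆⇒length≤ {xs = x ∷ xs} (x∉xs ∷ xs!) xs⊆ys with us , vs , refl ← ∈-∃++ (xs⊆ys (here refl)) = begin
  suc (length xs)               ≤⟨ s≤s (Unique∧⊆⇒length≤ xs! xs⊆us++vs) ⟩
  suc (length (us ++ vs))       ≡⟨ cong suc (length-++ us) ⟩
  suc (length us + length vs)   ≡⟨ +-suc (length us) (length vs) ⟨
  length us + length (x ∷ vs)   ≡⟨ length-++ us ⟨
  length (us ++ x ∷ vs)         ∎
  where
  open ≤-Reasoning
  xs⊆us++vs : xs ⊆ us ++ vs
  xs⊆us++vs z∈xs with ∈-++⁻ us (xs⊆ys (there z∈xs))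
  ... | inj₁ z∈us = ∈-++⁺ˡ z∈us
  ... | inj₂ (here refl) = ⊥-elim (All.lookup x∉xs z∈xs refl)
  ... | inj₂ (there z∈vs) = ∈-++⁺ʳ us z∈vs

length-concat-tabulate : ∀ {k} {B : Set} (g : Fin k → List B) →
  length (concat (tabulate g)) ≡ ∑[ j < k ] length (g j)
length-concat-tabulate {zero} g = refl
length-concat-tabulate {suc k} g =
  trans (length-++ (g zero)) (cong (length (g zero) +_) (length-concat-tabulate (g ∘ suc)))

module _ {A : Set} {n : ℕ} where

  columnwise : (Fin n → List A) → List (A × Fin n)
  columnwise rows = concat (tabulate λ j → map (_, j) (rows j))

  length-columnwise : ∀ rows → length (columnwise rows) ≡ ∑[ j < n ] length (rows j)
  length-columnwise rows =
    trans (length-concat-tabulate (λ j → map (_, j) (rows j))) (sum-cong-≗ λ j → length-map (_, j) (rows j))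

  ∈-columnwise⁺ : ∀ rows {x j} → x ∈ rows j → (x , j) ∈ columnwise rows
  ∈-columnwise⁺ _ {j = j} x∈rows = ∈-concat⁺′ (∈-map⁺ (_, j) x∈rows) (∈-tabulate⁺ j)

  ∈-columnwise⁻ : ∀ rows {x j} → (x , j) ∈ columnwise rows → x ∈ rows j
  ∈-columnwise⁻ rows v∈ with _ , v∈xs , xs∈ ← ∈-concat⁻′ _ v∈
    with i , refl ← ∈-tabulate⁻ {f = λ j → map (_, j) (rows j)} xs∈
    with _ , x∈rows , refl ← ∈-map⁻ (_, i) v∈xs = x∈rows

  columnwise-unique : ∀ rows → (∀ j → Unique (rows j)) → Unique (columnwise rows)
  columnwise-unique rows rows! =
    concat⁺ (Allₚ.tabulate⁺ λ j → map⁺ (cong proj₁) (rows! j)) (AllPairs.tabulate⁺ disjoint)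
    where
    disjoint : ∀ {i j} → i ≢ j → Disjoint (map (_, i) (rows i)) (map (_, j) (rows j))
    disjoint i≢j (v∈i , v∈j) with _ , _ , refl ← ∈-map⁻ _ v∈i with _ , _ , eq ← ∈-map⁻ _ v∈j =
      i≢j (cong proj₂ eq)

*≤∑ : ∀ {k b} (f : Fin k → ℕ) → (∀ i → b ≤ f i) → k * b ≤ ∑[ i < k ] f i
*≤∑ {zero} f _ = z≤n
*≤∑ {suc k} f b≤f = +-mono-≤ (b≤f zero) (*≤∑ (f ∘ suc) (b≤f ∘ suc))

∑-toℕ-+ : ∀ a {c} (h : ℕ → ℕ) →
  ∑[ j < a + c ] h (toℕ j) ≡ ∑[ j < a ] h (toℕ j) + ∑[ j < c ] h (a + toℕ j)
∑-toℕ-+ zero h = refl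
∑-toℕ-+ (suc a) h = trans (cong (h 0 +_) (∑-toℕ-+ a (h ∘ suc))) (sym (+-assoc (h 0) _ _))

≤m+m⇒⌈n/2⌉≤m : ∀ {n m} → n ≤ m + m → ⌈ n /2⌉ ≤ m
≤m+m⇒⌈n/2⌉≤m {n} {m} n≤2m = ≤-trans (⌈n/2⌉-mono n≤2m) (≤-reflexive (sym (n≡⌈n+n/2⌉ m)))

⌈m*2+n/2⌉≡m+⌈n/2⌉ : ∀ m n → ⌈ m * 2 + n /2⌉ ≡ m + ⌈ n /2⌉
⌈m*2+n/2⌉≡m+⌈n/2⌉ zero n = refl
⌈m*2+n/2⌉≡m+⌈n/2⌉ (suc m) n = cong suc (⌈m*2+n/2⌉≡m+⌈n/2⌉ m n)

module _ {p q : ℕ} where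

  _≟ᵛ_ : (v w : Fin p × Fin q) → Dec (v ≡ w)
  _≟ᵛ_ = ≡-dec _≟_ _≟_

  open import Data.List.Membership.DecPropositional _≟ᵛ_ public using (_∈?_)

Succ? : ∀ k (i j : Fin k) → Dec (Succ k i j)
Succ? k i j = (toℕ j ℕ.≟ suc (toℕ i)) ⊎-dec ((suc (toℕ i) ℕ.≟ k) ×-dec (toℕ j ℕ.≟ 0))

C-adj? : ∀ k (i j : Fin k) → Dec (Adj (C k) i j)
C-adj? k i j = Succ? k i j ⊎-dec Succ? k j i

□-adj? : ∀ p q (v w : Fin p × Fin q) → Dec (Adj (C p □ C q) v w)
□-adj? p q (r , c) (r′ , c′) = ((r ≟ r′) ×-dec C-adj? q c c′) ⊎-dec ((c ≟ c′) ×-dec C-adj? p r r′)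

∀Σ? : ∀ {p} {q : Fin p → ℕ} {P : Σ (Fin p) (λ b → Fin (q b)) → Set} →
  (∀ v → Dec (P v)) → Dec (∀ v → P v)
∀Σ? P? = map′ (λ all-bi (b , i) → all-bi b i) (λ all-v b i → all-v (b , i))
  (all? λ b → all? λ i → P? (b , i))

-- The cube C₄ × C₂

Cube : Graph
Cube = C 4 □ C 2

IsCycle : (G : Graph) {m : ℕ} → (Fin (3 + m) → V G) → Set
IsCycle G {m} f = Injective _≡_ _≡_ f × (∀ i j → Adj (C (3 + m)) i j → Adj G (f i) (f j))

IsCycle? : ∀ {m} (f : Fin (3 + m) → V Cube) → Dec (IsCycle Cube f)
IsCycle? {m} f =
  map′ (λ inj → λ {i} {j} → inj i j) (λ inj i j → inj {i} {j})
       (all? λ i → all? λ j → (f i ≟ᵛ f j) →-dec (i ≟ j))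
  ×-dec (all? λ i → all? λ j → C-adj? (3 + m) i j →-dec □-adj? 4 2 (f i) (f j))

CubeCycle : Set
CubeCycle = Σ ℕ λ m → Vec (V Cube) (3 + m)

layer : Fin 2 → CubeCycle
layer c = 1 , (0F , c) ∷ (1F , c) ∷ (2F , c) ∷ (3F , c) ∷ []

side : Fin 4 → CubeCycle
side r = 1 , (r , 0F) ∷ (next r , 0F) ∷ (next r , 1F) ∷ (r , 1F) ∷ []

-- The hexagon missing the antipodal vertices (r , 0) and (r + 2 , 1).
belt : Fin 4 → CubeCycle
belt r = 3 , (r₁ , 0F) ∷ (r₂ , 0F) ∷ (r₃ , 0F) ∷ (r₃ , 1F) ∷ (r , 1F) ∷ (r₁ , 1F) ∷ []
  where r₁ = next r ; r₂ = next r₁ ; r₃ = next r₂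

cube-cycles : List CubeCycle
cube-cycles = map layer (allFin 2) ++ map side (allFin 4) ++ map belt (allFin 4)

cube-cycles-are-cycles : All (λ (m , c) → IsCycle Cube (Vec.lookup c)) cube-cycles
cube-cycles-are-cycles = toWitness {a? = All.all? (λ (m , c) → IsCycle? (Vec.lookup c)) cube-cycles} _

Avoids : List (V Cube) → CubeCycle → Set
Avoids S (m , c) = ∀ i → Vec.lookup c i ∉ S

cube-cycles-avoid-pairs : ∀ x y → Any (Avoids (x ∷ y ∷ [])) cube-cycles
cube-cycles-avoid-pairs = toWitness {a? = ∀Σ? λ x → ∀Σ? λ y →
  Any.any? (λ (m , c) → all? λ i → ¬? (Vec.lookup c i ∈? (x ∷ y ∷ []))) cube-cycles} _

cycle-avoiding : ∀ {S} (c : CubeCycle) → IsCycle Cube (Vec.lookup (proj₂ c)) → Avoids S c →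
  ∃[ m ] CycleAvoiding Cube S m
cycle-avoiding (m , c) (c-injective , c-edges) c-avoids = m , Vec.lookup c , c-injective , c-avoids , c-edges

cube-cycle-avoiding : ∀ x y → ∃[ m ] CycleAvoiding Cube (x ∷ y ∷ []) m
cube-cycle-avoiding x y = uncurry (cycle-avoiding (Any.lookup (cube-cycles-avoid-pairs x y)))
  (All.lookupAny cube-cycles-are-cycles (cube-cycles-avoid-pairs x y))

cube-acyclic⇒3≤length : ∀ S → AcyclicAfterRemoving Cube S → 3 ≤ length S
cube-acyclic⇒3≤length [] acyclic = ⊥-elim (uncurry acyclic
  (Product.map₂ (cycle-avoiding-⊆ {G = Cube} λ ()) (cube-cycle-avoiding (0F , 0F) (0F , 0F))))
cube-acyclic⇒3≤length (x ∷ []) acyclic = ⊥-elim (uncurry acyclic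
  (Product.map₂ (cycle-avoiding-⊆ {G = Cube} λ { (here refl) → here refl }) (cube-cycle-avoiding x x)))
cube-acyclic⇒3≤length (x ∷ y ∷ []) acyclic = ⊥-elim (uncurry acyclic (cube-cycle-avoiding x y))
cube-acyclic⇒3≤length (_ ∷ _ ∷ _ ∷ _) _ = s≤s (s≤s (s≤s z≤n))

-- The lower bound

module _ {p n : ℕ} {a b : Fin n} (a→b : Succ n a b) (a≢b : a ≢ b) where

  column-pair : Fin p × Fin 2 → Fin p × Fin n
  column-pair (r , 0F) = r , a
  column-pair (r , 1F) = r , b

  column-pair-injective : Injective _≡_ _≡_ column-pair
  column-pair-injective {r , 0F} {.r , 0F} refl = refl
  column-pair-injective {r , 0F} {r′ , 1F} eq = ⊥-elim (a≢b (cong proj₂ eq))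
  column-pair-injective {r , 1F} {r′ , 0F} eq = ⊥-elim (a≢b (sym (cong proj₂ eq)))
  column-pair-injective {r , 1F} {.r , 1F} refl = refl

  column-pair-adj : ∀ {v w} → Adj (C p □ C 2) v w → Adj (C p □ C n) (column-pair v) (column-pair w)
  column-pair-adj {_ , 0F} {_ , 1F} (inj₁ (refl , _)) = inj₁ (refl , inj₁ a→b)
  column-pair-adj {_ , 1F} {_ , 0F} (inj₁ (refl , _)) = inj₁ (refl , inj₂ a→b)
  column-pair-adj {_ , 0F} {_ , 0F} (inj₁ (_ , 0~0)) = ⊥-elim ([ Succ-irrefl ≤-refl , Succ-irrefl ≤-refl ] 0~0)
  column-pair-adj {_ , 1F} {_ , 1F} (inj₁ (_ , 1~1)) = ⊥-elim ([ Succ-irrefl ≤-refl , Succ-irrefl ≤-refl ] 1~1)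
  column-pair-adj {_ , 0F} {_ , .0F} (inj₂ (refl , r~r′)) = inj₂ (refl , r~r′)
  column-pair-adj {_ , 1F} {_ , .1F} (inj₂ (refl , r~r′)) = inj₂ (refl , r~r′)

module _ {n : ℕ} (S : List (Fin 4 × Fin n)) where

  rows-in : Fin n → List (Fin 4)
  rows-in j = filter (λ r → (r , j) ∈? S) (allFin 4)

  column-pair-bound : AcyclicAfterRemoving (C 4 □ C n) S → ∀ {a b} → Succ n a b → a ≢ b →
    3 ≤ length (rows-in a) + length (rows-in b)
  column-pair-bound acyclic {a} {b} a→b a≢b =
    subst (3 ≤_) length-pulled (cube-acyclic⇒3≤length pulled (acyclic-pullback {G = C 4 □ C n} {H = Cube}
      (column-pair a→b a≢b) (column-pair-injective a→b a≢b) (column-pair-adj a→b a≢b) back acyclic))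
    where
    pulled : List (V Cube)
    pulled = map (_, 0F) (rows-in a) ++ map (_, 1F) (rows-in b)
    back : ∀ {x} → column-pair a→b a≢b x ∈ S → x ∈ pulled
    back {r , 0F} x∈S = ∈-++⁺ˡ (∈-map⁺ (_, 0F) (∈-filter⁺ (λ r → (r , a) ∈? S) (∈-allFin r) x∈S))
    back {r , 1F} x∈S = ∈-++⁺ʳ (map (_, 0F) (rows-in a))
      (∈-map⁺ (_, 1F) (∈-filter⁺ (λ r → (r , b) ∈? S) (∈-allFin r) x∈S))
    length-pulled : length pulled ≡ length (rows-in a) + length (rows-in b)
    length-pulled = trans (length-++ (map (_, 0F) (rows-in a)))
      (cong₂ _+_ (length-map _ (rows-in a)) (length-map _ (rows-in b)))

  ∑-rows-in≤length : ∑[ j < n ] length (rows-in j) ≤ length S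
  ∑-rows-in≤length = subst (_≤ length S) (length-columnwise rows-in)
    (Unique∧⊆⇒length≤ (columnwise-unique rows-in λ j → filter⁺ (λ r → (r , j) ∈? S) (allFin⁺ 4)) in-S)
    where
    in-S : columnwise rows-in ⊆ S
    in-S {r , j} v∈ = proj₂ (∈-filter⁻ (λ r → (r , j) ∈? S) (∈-columnwise⁻ rows-in v∈))

decycling-lower-bound : ∀ {n} → 2 ≤ n → (S : List (Fin 4 × Fin n)) → AcyclicAfterRemoving (C 4 □ C n) S →
  ⌈ 3 * n /2⌉ ≤ length S
decycling-lower-bound {suc k} 2≤n S acyclic = ≤m+m⇒⌈n/2⌉≤m (begin
  3 * suc k
    ≡⟨ *-comm 3 (suc k) ⟩
  suc k * 3
    ≤⟨ *≤∑ _ (λ j → column-pair-bound S acyclic (Succ-next j) (next≢ j)) ⟩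
  ∑[ j < suc k ] (count j + count (next j))
    ≡⟨ ∑-distrib-+ count (count ∘ next) ⟩
  ∑[ j < suc k ] count j + ∑[ j < suc k ] count (next j)
    ≡⟨ cong (∑[ j < suc k ] count j +_) (∑-permute count rotation) ⟨
  ∑[ j < suc k ] count j + ∑[ j < suc k ] count j
    ≤⟨ +-mono-≤ (∑-rows-in≤length S) (∑-rows-in≤length S) ⟩
  length S + length S ∎)
  where
  open ≤-Reasoning
  count : Fin (suc k) → ℕ
  count j = length (rows-in S j)
  next≢ : ∀ j → j ≢ next j
  next≢ j j≡next = Succ-irrefl 2≤n (subst (Succ (suc k) j) (sym j≡next) (Succ-next j))

-- The upper bound

-- ✗ marks a deleted vertex, just ρ a kept vertex of rank ρ.
Cell : Set
Cell = Maybe ℕ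

pattern ✗ = nothing

block : (b : Fin 4) → Vec (Vec Cell 4) (4 + toℕ b)
block 0F = (✗ ∷ just 2 ∷ just 1 ∷ just 2 ∷ [])
         ∷ (just 1 ∷ ✗ ∷ just 0 ∷ ✗ ∷ [])
         ∷ (just 0 ∷ just 1 ∷ ✗ ∷ just 1 ∷ [])
         ∷ (just 1 ∷ ✗ ∷ just 2 ∷ ✗ ∷ [])
         ∷ []
block 1F = (✗ ∷ just 0 ∷ just 1 ∷ just 2 ∷ [])
         ∷ (✗ ∷ just 1 ∷ ✗ ∷ just 3 ∷ [])
         ∷ (just 5 ∷ ✗ ∷ just 5 ∷ just 4 ∷ [])
         ∷ (✗ ∷ just 0 ∷ ✗ ∷ just 5 ∷ [])
         ∷ (just 0 ∷ ✗ ∷ just 2 ∷ ✗ ∷ [])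
         ∷ []
block 2F = (✗ ∷ just 0 ∷ just 1 ∷ just 2 ∷ [])
         ∷ (✗ ∷ just 1 ∷ ✗ ∷ just 3 ∷ [])
         ∷ (just 5 ∷ ✗ ∷ just 5 ∷ just 4 ∷ [])
         ∷ (✗ ∷ just 9 ∷ ✗ ∷ just 5 ∷ [])
         ∷ (just 7 ∷ just 8 ∷ ✗ ∷ just 6 ∷ [])
         ∷ (just 8 ∷ ✗ ∷ just 2 ∷ ✗ ∷ [])
         ∷ []
block 3F = (✗ ∷ just 0 ∷ just 1 ∷ just 2 ∷ [])
         ∷ (✗ ∷ just 1 ∷ ✗ ∷ just 3 ∷ [])
         ∷ (just 5 ∷ ✗ ∷ just 5 ∷ just 4 ∷ [])
         ∷ (✗ ∷ just 9 ∷ ✗ ∷ just 5 ∷ [])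
         ∷ (✗ ∷ just 8 ∷ just 7 ∷ just 6 ∷ [])
         ∷ (✗ ∷ just 9 ∷ ✗ ∷ just 7 ∷ [])
         ∷ (just 0 ∷ ✗ ∷ just 2 ∷ ✗ ∷ [])
         ∷ []

Slot : Set
Slot = Σ (Fin 4) λ b → Fin (4 + toℕ b)

cell : Slot → Fin 4 → Cell
cell (b , i) r = Vec.lookup (Vec.lookup (block b) i) r

deleted-rows : Slot → List (Fin 4)
deleted-rows s = filter (λ r → T? (is-nothing (cell s r))) (allFin 4)

_↝_ : Slot → Slot → Set
(b , i) ↝ (b′ , i′) =
  (b ≡ b′ × toℕ i′ ≡ suc (toℕ i)) ⊎ (suc (toℕ i) ≡ 4 + toℕ b × toℕ i′ ≡ 0)

_↝?_ : ∀ s t → Dec (s ↝ t)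
(b , i) ↝? (b′ , i′) =
  ((b ≟ b′) ×-dec (toℕ i′ ℕ.≟ suc (toℕ i))) ⊎-dec ((suc (toℕ i) ℕ.≟ 4 + toℕ b) ×-dec (toℕ i′ ℕ.≟ 0))

data Direction : Set where
  left right up down : Direction

directions : List Direction
directions = left ∷ right ∷ up ∷ down ∷ []

∈-directions : ∀ d → d ∈ directions
∈-directions left = here refl
∈-directions right = there (here refl)
∈-directions up = there (there (here refl))
∈-directions down = there (there (there (here refl)))

_≼_ : Cell → Cell → Set
just x ≼ just y = x ≤ y
_ ≼ _ = ⊥

_≼?_ : ∀ x y → Dec (x ≼ y)
just x ≼? just y = x ℕ.≤? y
just _ ≼? nothing = no λ ()
nothing ≼? _ = no λ ()

window : Slot → Slot → Slot → Fin 4 → Direction → Cell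
window s t u r left = cell s r
window s t u r right = cell u r
window s t u r up = cell t (next r)
window s t u r down = cell t (prev r)

lower-directions : Slot → Slot → Slot → Fin 4 → List Direction
lower-directions s t u r = filter (λ d → window s t u r d ≼? cell t r) directions

local-check : ∀ s t → s ↝ t → ∀ u → t ↝ u → ∀ r → length (lower-directions s t u r) ≤ 1
local-check = toWitness {a? = ∀Σ? λ s → ∀Σ? λ t → (s ↝? t) →-dec ∀Σ? λ u → (t ↝? u) →-dec
  all? λ r → length (lower-directions s t u r) ℕ.≤? 1} _

∈-length≤1 : ∀ {A : Set} {x y : A} {xs} → x ∈ xs → y ∈ xs → length xs ≤ 1 → x ≡ y
∈-length≤1 {xs = _ ∷ []} (here refl) (here refl) _ = refl
∈-length≤1 {xs = _ ∷ _ ∷ _} _ _ (s≤s ())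

module _ {p q : ℕ} where

  neighbour : Fin (suc p) × Fin (suc q) → Direction → Fin (suc p) × Fin (suc q)
  neighbour (r , j) left = r , prev j
  neighbour (r , j) right = r , next j
  neighbour (r , j) up = next r , j
  neighbour (r , j) down = prev r , j

  □-neighbour : ∀ {v u} → Adj (C (suc p) □ C (suc q)) v u → ∃[ d ] u ≡ neighbour v d
  □-neighbour {r , j} (inj₁ (refl , j~j′)) with C-neighbour {i = j} j~j′
  ... | inj₁ refl = right , refl
  ... | inj₂ refl = left , refl
  □-neighbour {r , j} (inj₂ (refl , r~r′)) with C-neighbour {i = r} r~r′
  ... | inj₁ refl = up , refl
  ... | inj₂ refl = down , refl

module _ {m : ℕ} (τ : Fin (suc m) → Slot) where

  deleted : List (Fin 4 × Fin (suc m))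
  deleted = columnwise (deleted-rows ∘ τ)

  rank : Fin 4 × Fin (suc m) → ℕ
  rank (r , j) = fromMaybe 0 (cell (τ j) r)

  kept : ∀ {r j} → (r , j) ∉ deleted → cell (τ j) r ≡ just (rank (r , j))
  kept {r} {j} v∉ with cell (τ j) r in eq
  ... | just _ = refl
  ... | nothing = ⊥-elim (v∉ (∈-columnwise⁺ (deleted-rows ∘ τ)
    (∈-filter⁺ (λ r → T? (is-nothing (cell (τ j) r))) (∈-allFin r) (subst (T ∘ is-nothing) (sym eq) tt))))

  window-neighbour : ∀ r j d → window (τ (prev j)) (τ j) (τ (next j)) r d ≡
    cell (τ (proj₂ (neighbour (r , j) d))) (proj₁ (neighbour (r , j) d))
  window-neighbour r j left = refl
  window-neighbour r j right = refl
  window-neighbour r j up = refl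
  window-neighbour r j down = refl

  deleted-decycling : (∀ {j j′} → Succ (suc m) j j′ → τ j ↝ τ j′) →
    IsDecyclingSet (C 4 □ C (suc m)) deleted
  deleted-decycling τ-↝ =
    columnwise-unique (deleted-rows ∘ τ) (λ j → filter⁺ (λ r → T? (is-nothing (cell (τ j) r))) (allFin⁺ 4)) ,
    acyclic-by-rank (C 4 □ C (suc m)) deleted rank lower-unique
    where
    lower-unique : ∀ {v u w} → v ∉ deleted → u ∉ deleted → w ∉ deleted →
      Adj (C 4 □ C (suc m)) v u → Adj (C 4 □ C (suc m)) v w →
      rank u ≤ rank v → rank w ≤ rank v → u ≡ w
    lower-unique {r , j} v∉ u∉ w∉ v~u v~w u≤v w≤v with □-neighbour v~u | □-neighbour v~w
    ... | d , refl | d′ , refl =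
      cong (neighbour (r , j)) (∈-length≤1 (lower d u∉ u≤v) (lower d′ w∉ w≤v)
        (local-check _ _ (τ-↝ (Succ-prev j)) _ (τ-↝ (Succ-next j)) r))
      where
      lower : ∀ d → neighbour (r , j) d ∉ deleted → rank (neighbour (r , j) d) ≤ rank (r , j) →
        d ∈ lower-directions (τ (prev j)) (τ j) (τ (next j)) r
      lower d n∉ n≤v =
        ∈-filter⁺ (λ d → window (τ (prev j)) (τ j) (τ (next j)) r d ≼? cell (τ j) r) (∈-directions d)
          (subst₂ _≼_ (sym (trans (window-neighbour r j d) (kept n∉))) (sym (kept v∉)) n≤v)

-- Opaque, so that unification never unfolds iterated applications of advance.
opaque
  advance : Slot → Slot
  advance (b , i) with suc (toℕ i) <? 4 + toℕ b
  ... | yes i+1<ℓ = b , fromℕ< i+1<ℓ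
  ... | no _ = 0F , zero

opaque
  unfolding advance

  ↝-advance : ∀ s → s ↝ advance s
  ↝-advance (b , i) with suc (toℕ i) <? 4 + toℕ b
  ... | yes i+1<ℓ = inj₁ (refl , toℕ-fromℕ< i+1<ℓ)
  ... | no i+1≮ℓ = inj₂ (≤-antisym (toℕ<n i) (≮⇒≥ i+1≮ℓ) , refl)

  ↝-restart : ∀ s {t} → advance s ≡ (0F , zero) → s ↝ (t , zero)
  ↝-restart (b , i) eq with suc (toℕ i) <? 4 + toℕ b
  ... | yes i+1<ℓ = ⊥-elim (0≢1+n (trans (sym (cong (toℕ ∘ proj₂) eq)) (toℕ-fromℕ< i+1<ℓ)))
  ... | no i+1≮ℓ = inj₂ (≤-antisym (toℕ<n i) (≮⇒≥ i+1≮ℓ) , refl)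

-- Block b followed by copies of block 0F.
word : Fin 4 → ℕ → Slot
word b = fold (b , zero) advance

deletions : Fin 4 → ℕ → ℕ
deletions b q = length (deleted-rows (word b q))

opaque
  unfolding advance

  block-closes : ∀ b → word b (4 + toℕ b) ≡ (0F , zero)
  block-closes 0F = refl
  block-closes 1F = refl
  block-closes 2F = refl
  block-closes 3F = refl

  block-deletions : ∀ b → ∑[ j < 4 + toℕ b ] deletions b (toℕ j) ≡ ⌈ 3 * (4 + toℕ b) /2⌉
  block-deletions 0F = refl
  block-deletions 1F = refl
  block-deletions 2F = refl
  block-deletions 3F = refl

base-period : ∀ q → word 0F (q + 4) ≡ word 0F q
base-period q = trans (fold-+ (0F , zero) advance q) (cong (λ s → fold s advance q) (block-closes 0F))

base-closes : ∀ k → word 0F (k * 4) ≡ (0F , zero)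
base-closes zero = refl
base-closes (suc k) = trans (cong (word 0F) (+-comm 4 (k * 4))) (trans (base-period (k * 4)) (base-closes k))

word-after-block : ∀ b q → word b (4 + toℕ b + q) ≡ word 0F q
word-after-block b q = begin
  word b (4 + toℕ b + q)                   ≡⟨ cong (word b) (+-comm (4 + toℕ b) q) ⟩
  word b (q + (4 + toℕ b))                 ≡⟨ fold-+ (b , zero) advance q ⟩
  fold (word b (4 + toℕ b)) advance q      ≡⟨ cong (λ s → fold s advance q) (block-closes b) ⟩
  word 0F q                                ∎
  where open ≡-Reasoning

word-↝ : ∀ b k {j j′ : Fin (4 + toℕ b + k * 4)} → Succ _ j j′ → word b (toℕ j) ↝ word b (toℕ j′)
word-↝ b k {j} (inj₁ j′≡j+1) rewrite j′≡j+1 = ↝-advance (word b (toℕ j))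
word-↝ b k {j} (inj₂ (j+1≡n , j′≡0)) rewrite j′≡0 =
  ↝-restart (word b (toℕ j)) (trans (cong (word b) j+1≡n) (trans (word-after-block b (k * 4)) (base-closes k)))

base-deletions : ∀ k → ∑[ j < k * 4 ] deletions 0F (toℕ j) ≡ k * 6
base-deletions zero = refl
base-deletions (suc k) = begin
  ∑[ j < suc k * 4 ] deletions 0F (toℕ j)
    ≡⟨ ∑-toℕ-+ 4 {k * 4} (deletions 0F) ⟩
  ∑[ j < 4 ] deletions 0F (toℕ j) + ∑[ j < k * 4 ] deletions 0F (4 + toℕ j)
    ≡⟨ cong₂ _+_ (block-deletions 0F) (sum-cong-≗ {k * 4} λ j → cong (deletions 0F) (+-comm 4 (toℕ j))) ⟩
  6 + ∑[ j < k * 4 ] deletions 0F (toℕ j + 4)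
    ≡⟨ cong (6 +_) (sum-cong-≗ {k * 4} λ j → cong (length ∘ deleted-rows) (base-period (toℕ j))) ⟩
  6 + ∑[ j < k * 4 ] deletions 0F (toℕ j)
    ≡⟨ cong (6 +_) (base-deletions k) ⟩
  suc k * 6 ∎
  where open ≡-Reasoning

word-deletions : ∀ b k →
  ∑[ j < 4 + toℕ b + k * 4 ] deletions b (toℕ j) ≡ ⌈ 3 * (4 + toℕ b + k * 4) /2⌉
word-deletions b k = begin
  ∑[ j < ℓ + k * 4 ] deletions b (toℕ j)
    ≡⟨ ∑-toℕ-+ ℓ {k * 4} (deletions b) ⟩
  ∑[ j < ℓ ] deletions b (toℕ j) + ∑[ j < k * 4 ] deletions b (ℓ + toℕ j)
    ≡⟨ cong₂ _+_ (block-deletions b)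
         (sum-cong-≗ {k * 4} λ j → cong (length ∘ deleted-rows) (word-after-block b (toℕ j))) ⟩
  ⌈ 3 * ℓ /2⌉ + ∑[ j < k * 4 ] deletions 0F (toℕ j)
    ≡⟨ cong (⌈ 3 * ℓ /2⌉ +_) (base-deletions k) ⟩
  ⌈ 3 * ℓ /2⌉ + k * 6
    ≡⟨ +-comm ⌈ 3 * ℓ /2⌉ (k * 6) ⟩
  k * 6 + ⌈ 3 * ℓ /2⌉
    ≡⟨ ⌈m*2+n/2⌉≡m+⌈n/2⌉ (k * 6) (3 * ℓ) ⟨
  ⌈ k * 6 * 2 + 3 * ℓ /2⌉
    ≡⟨ cong ⌈_/2⌉ (three-times ℓ k) ⟨
  ⌈ 3 * (ℓ + k * 4) /2⌉ ∎
  where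
  open ≡-Reasoning
  ℓ = 4 + toℕ b
  three-times : ∀ ℓ k → 3 * (ℓ + k * 4) ≡ k * 6 * 2 + 3 * ℓ
  three-times = solve-∀

decycling-upper-bound : ∀ b k → let n = 4 + toℕ b + k * 4 in
  Σ (List (V (C 4 □ C n))) λ S → IsDecyclingSet (C 4 □ C n) S × length S ≡ ⌈ 3 * n /2⌉
decycling-upper-bound b k =
  deleted τ , deleted-decycling τ (word-↝ b k) ,
  trans (length-columnwise (deleted-rows ∘ τ)) (word-deletions b k)
  where
  τ : Fin (4 + toℕ b + k * 4) → Slot
  τ j = word b (toℕ j)

block-decomposition : ∀ n → 4 ≤ n → Σ (Fin 4) λ b → ∃[ k ] n ≡ 4 + toℕ b + k * 4
block-decomposition _ (s≤s (s≤s (s≤s (s≤s {n = m} _)))) with result k b m≡b+4k ← m divMod 4 =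
  b , k , cong (4 +_) m≡b+4k

theorem3 : ∀ (n : ℕ) → 4 ≤ n → DecyclingNumber (C 4 □ C n) ⌈ 3 * n /2⌉
theorem3 n 4≤n with b , k , refl ← block-decomposition n 4≤n =
  decycling-upper-bound b k ,
  λ S (_ , acyclic) → decycling-lower-bound (≤-trans (s≤s (s≤s z≤n)) 4≤n) S acyclic
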